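{- Every polynomial with nonnegative integer coefficients and with constant term $1$ is the dual visibility polynomial $\mathcal{V}_{\rm d}(G)$ of some connected graph $G$.
   Context: For a graph $G$ and $X\subseteq V(G)$, two vertices $x,y$ are $X$-visible if there is a shortest $x,y$-path in $G$ with no internal vertex in $X$. $X$ is a dual mutual-visibility set if any two vertices of $X$ are $X$-visible and any two vertices of $V(G)\setminus X$ are $X$-visible. The dual visibility polynomial is $\mathcal{V}_{\rm d}(G)=\sum_{i\ge 0} r_i x^i$, where $r_i$ is the number of dual mutual-visibility sets of $G$ of cardinality $i$ (the empty set counts, so $r_0=1$). -}

module Defs where

open import Data.Nat using (ℕ; zero; suc; _≤_; _<_)
open import Data.Fin using (Fin)
open import Data.Fin.Subset using (Subset; _∈_; _∉_; ∣_∣)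
open import Data.List using (List; []; _∷_; length)
open import Data.List.Relation.Unary.Unique.Propositional using (Unique)
import Data.List.Membership.Propositional as LM
open import Data.Product using (Σ; ∃; _×_)
open import Data.Unit using (⊤)
open import Data.Empty using (⊥)
open import Relation.Nullary using (¬_)
open import Relation.Binary.PropositionalEquality using (_≡_)
open import Function.Bundles using (_⇔_)

record Graph : Set₁ where
  field
    order : ℕ
    Adj   : Fin order → Fin order → Set
    sym   : ∀ {x y} → Adj x y → Adj y x
    irrefl : ∀ {x} → ¬ Adj x x

module _ (G : Graph) where
  open Graph G

  data Walk : Fin order → Fin order → ℕ → Set where
    nil  : ∀ {x} → Walk x x 0
    cons : ∀ {x y z k} → Adj x y → Walk y z k → Walk x z (suc k)

  NoInternalIn : Subset order → ∀ {x y k} → Walk x y k → Set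
  NoInternalIn X nil = ⊤
  NoInternalIn X (cons e nil) = ⊤
  NoInternalIn X (cons {y = y} e (cons e′ w)) = (y ∉ X) × NoInternalIn X (cons e′ w)

  IsShortest : ∀ {x y k} → Walk x y k → Set
  IsShortest {x} {y} {k} w = ∀ m → Walk x y m → k ≤ m

  Connected : Set
  Connected = ∀ x y → ∃ λ k → Walk x y k

  Visible : Subset order → Fin order → Fin order → Set
  Visible X x y = Σ ℕ λ k → Σ (Walk x y k) λ w → IsShortest w × NoInternalIn X w

  DualMutualVisibility : Subset order → Set
  DualMutualVisibility X =
    (∀ x y → x ∈ X → y ∈ X → Visible X x y) ×
    (∀ x y → x ∉ X → y ∉ X → Visible X x y)

  -- r is the number of dual mutual-visibility sets of cardinality i
  -- (witnessed by a duplicate-free list enumerating exactly those sets)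
  DualVisCoeff : ℕ → ℕ → Set
  DualVisCoeff i r = Σ (List (Subset order)) λ L →
    Unique L × (∀ X → (X LM.∈ L) ⇔ (DualMutualVisibility X × ∣ X ∣ ≡ i)) × length L ≡ r

coeff : List ℕ → ℕ → ℕ
coeff [] i = 0
coeff (c ∷ cs) zero = c
coeff (c ∷ cs) (suc i) = coeff cs i

-- Write the polynomial as 1 + Σ_d c_d x^(d+1). The graph has, for every d, c_d cliques ("blocks") on
-- d + 1 vertices, together with anchor vertices each carrying three pendant Petersen graphs.
-- If r is the unique common neighbour of each pair among three pairwise non-adjacent vertices, then r
-- lies outside every dual mutual-visibility set X: two of the three lie on the same side of X and see
-- each other only through r. Every anchor and, by girth 5, every Petersen vertex is such a centre.
-- A tag anchor on each block vertex forces X to contain a whole block as soon as it meets it, and two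
-- non-adjacent separator anchors per pair of blocks, whose common neighbours lie in those blocks, forbid
-- X to meet two blocks. Conversely every block is a dual mutual-visibility set: it is a clique, and a
-- shortest path between outside vertices that passes through it can be rerouted around it, via two hubs
-- or the separators, without getting longer. So the nonempty such sets are exactly the blocks.
module Submission where

open import Defs
open import Data.Bool using (true; false)
open import Data.Empty using (⊥; ⊥-elim)
open import Data.Fin using (Fin; zero; suc; _≟_; #_; _↑ˡ_; _↑ʳ_; splitAt; remQuot; combine)
open import Data.Fin.Properties using (all?; any?; splitAt-↑ˡ; splitAt-↑ʳ; splitAt⁻¹-↑ˡ; splitAt⁻¹-↑ʳ; remQuot-combine; combine-remQuot)
open import Data.Fin.Subset using (Subset; _∈_; _∉_; _⊆_; ⊤; ∣_∣) renaming (⊥ to ∅)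
open import Data.Fin.Subset.Properties using (_∈?_; ∉⊥; ∈⊤; ∣⊤∣≡n; ∣⊥∣≡0; nonempty?; Empty-unique; ⊆-antisym)
open import Data.List as List using (List; []; _∷_; length; lookup; map; filter; replicate; allFin)
open import Data.List.Membership.Propositional using () renaming (_∈_ to _∈ₗ_)
open import Data.List.Membership.Propositional.Properties using (∈-map⁺; ∈-map⁻; ∈-filter⁺; ∈-filter⁻; ∈-allFin)
open import Data.List.Properties using (length-map; length-++; length-replicate; filter-++; filter-all; filter-none; filter-≐; map-tabulate; tabulate-lookup)
open import Data.List.Relation.Unary.All using ([]; universal)
import Data.List.Relation.Unary.All.Properties as All
open import Data.List.Relation.Unary.AllPairs using ([]; _∷_)
open import Data.List.Relation.Unary.Any using (here)
open import Data.List.Relation.Unary.Unique.Propositional using (Unique)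
import Data.List.Relation.Unary.Unique.Propositional.Properties as Unique
open import Data.Nat using (ℕ; zero; suc; _+_; _*_; _≤_; _<_; _≥_; z≤n; s≤s) renaming (_≟_ to _≟ℕ_)
open import Data.Nat.Properties using (≤-refl; ≤-trans; +-mono-≤; +-identityʳ; m≤n⇒m<n∨m≡n; ≮⇒≥; n<1+n; m≤n⇒m≤1+n; m≤n+m; suc-injective)
open import Data.Product using (Σ; ∃; _×_; _,_; proj₁; proj₂; uncurry)
open import Data.Sum using (_⊎_; inj₁; inj₂; [_,_]′)
open import Data.Unit using (tt)
open import Data.Vec as Vec using (Vec; []; _∷_; _++_; here; there)
open import Function using (_∘_; id)
open import Function.Bundles using (mk⇔)
open import Relation.Binary using (Decidable)
open import Relation.Binary.PropositionalEquality using (_≡_; _≢_; refl; cong; cong₂; sym; trans; subst; subst₂; module ≡-Reasoning)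
open import Relation.Nullary using (¬_; Dec; yes; no)
open import Relation.Nullary.Decidable using (does; map′; toWitness; _×-dec_; _⊎-dec_; _→-dec_; ¬?)
import Relation.Unary as Unary

open ≡-Reasoning

record UniqueMiddle {V : Set} (R : V → V → Set) (x y r : V) : Set where
  field
    distinct    : x ≢ y
    nonadjacent : ¬ R x y
    toMiddle    : R x r
    fromMiddle  : R r y
    unique      : ∀ m → R x m → R m y → m ≡ r

module Walks (G : Graph) where
  open Graph G using (Adj) renaming (sym to Adj-sym)

  _++ʷ_ : ∀ {x y z k l} → Walk G x y k → Walk G y z l → Walk G x z (k + l)
  nil      ++ʷ w = w
  cons e v ++ʷ w = cons e (v ++ʷ w)

  snocʷ : ∀ {x y z k} → Walk G x y k → Adj y z → Walk G x z (suc k)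
  snocʷ nil        e′ = cons e′ nil
  snocʷ (cons e w) e′ = cons e (snocʷ w e′)

  reverseʷ : ∀ {x y k} → Walk G x y k → Walk G y x k
  reverseʷ nil        = nil
  reverseʷ (cons e w) = snocʷ (reverseʷ w) (Adj-sym e)

  connected-via : ∀ hub → (∀ x → ∃ λ k → Walk G x hub k) → Connected G
  connected-via hub reach x y = _ , (proj₂ (reach x) ++ʷ reverseʷ (proj₂ (reach y)))

  noInternal-cons : ∀ {X x y z k} (e : Adj x y) (w : Walk G y z k) →
                    y ∉ X → NoInternalIn G X w → NoInternalIn G X (cons e w)
  noInternal-cons e nil         y∉ _  = tt
  noInternal-cons e (cons e′ w) y∉ ni = y∉ , ni

  noInternal-++ : ∀ {X x y z k l} (v : Walk G x y k) (w : Walk G y z l) →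
                  NoInternalIn G X v → y ∉ X → NoInternalIn G X w → NoInternalIn G X (v ++ʷ w)
  noInternal-++ nil                  w _          y∉ niw = niw
  noInternal-++ (cons e nil)         w _          y∉ niw = noInternal-cons e w y∉ niw
  noInternal-++ (cons e (cons e′ v)) w (m∉ , niv) y∉ niw = m∉ , noInternal-++ (cons e′ v) w niv y∉ niw

module Visibility (G : Graph) where
  open Graph G using (order; Adj)
  open Walks G

  record Blocked (X : Subset order) (x y : Fin order) : Set where
    field
      distinct    : x ≢ y
      nonadjacent : ¬ Adj x y
      middle      : Fin order
      toMiddle    : Adj x middle
      fromMiddle  : Adj middle y
      middles∈    : ∀ m → Adj x m → Adj m y → m ∈ X

  blocked⇒¬visible : ∀ {X x y} → Blocked X x y → ¬ Visible G X x y
  blocked⇒¬visible {X} b (k , w , shortest , ni) =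
    short w (shortest 2 (cons (toMiddle b) (cons (fromMiddle b) nil))) ni
    where
    open Blocked
    short : ∀ {k} (w : Walk G _ _ k) → k ≤ 2 → ¬ NoInternalIn G X w
    short nil                           _              _        = distinct b refl
    short (cons e nil)                  _              _        = nonadjacent b e
    short (cons e (cons e′ nil))        _              (m∉ , _) = m∉ (middles∈ b _ e e′)
    short (cons e (cons e′ (cons _ _))) (s≤s (s≤s ())) _

  SameSide : Subset order → Fin order → Fin order → Set
  SameSide X x y = (x ∈ X × y ∈ X) ⊎ (x ∉ X × y ∉ X)

  blocked⇒¬sameSide : ∀ {X x y} → DualMutualVisibility G X → Blocked X x y → ¬ SameSide X x y
  blocked⇒¬sameSide (inside , _) b (inj₁ (x∈ , y∈)) = blocked⇒¬visible b (inside _ _ x∈ y∈)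
  blocked⇒¬sameSide (_ , outside) b (inj₂ (x∉ , y∉)) = blocked⇒¬visible b (outside _ _ x∉ y∉)

  sameSide-pigeonhole : ∀ X a b c → SameSide X a b ⊎ SameSide X b c ⊎ SameSide X a c
  sameSide-pigeonhole X a b c with a ∈? X | b ∈? X | c ∈? X
  ... | yes a∈ | yes b∈ | _      = inj₁ (inj₁ (a∈ , b∈))
  ... | no a∉  | no b∉  | _      = inj₁ (inj₂ (a∉ , b∉))
  ... | yes a∈ | no b∉  | yes c∈ = inj₂ (inj₂ (inj₁ (a∈ , c∈)))
  ... | yes a∈ | no b∉  | no c∉  = inj₂ (inj₁ (inj₂ (b∉ , c∉)))
  ... | no a∉  | yes b∈ | yes c∈ = inj₂ (inj₁ (inj₁ (b∈ , c∈)))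
  ... | no a∉  | yes b∈ | no c∉  = inj₂ (inj₂ (inj₂ (a∉ , c∉)))

  uniqueMiddle⇒blocked : ∀ {X x y r} → UniqueMiddle Adj x y r → r ∈ X → Blocked X x y
  uniqueMiddle⇒blocked {X} u r∈ = record
    { distinct = distinct ; nonadjacent = nonadjacent ; middle = _
    ; toMiddle = toMiddle ; fromMiddle = fromMiddle
    ; middles∈ = λ m e e′ → subst (_∈ X) (sym (unique m e e′)) r∈ }
    where open UniqueMiddle u

  triangle-centre∉ : ∀ {X a b c r} → DualMutualVisibility G X →
    UniqueMiddle Adj a b r → UniqueMiddle Adj b c r → UniqueMiddle Adj a c r → r ∉ X
  triangle-centre∉ {X} {a} {b} {c} dmv ab bc ac r∈ with sameSide-pigeonhole X a b c
  ... | inj₁ s        = blocked⇒¬sameSide dmv (uniqueMiddle⇒blocked ab r∈) s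
  ... | inj₂ (inj₁ s) = blocked⇒¬sameSide dmv (uniqueMiddle⇒blocked bc r∈) s
  ... | inj₂ (inj₂ s) = blocked⇒¬sameSide dmv (uniqueMiddle⇒blocked ac r∈) s

  WalkAvoiding : Subset order → Fin order → Fin order → ℕ → Set
  WalkAvoiding B x y K = Σ ℕ λ k → k ≤ K × Σ (Walk G x y k) (NoInternalIn G B)

  Bypassable : Subset order → Set
  Bypassable B = ∀ {a b b′ d} → a ∉ B → b ∈ B → b′ ∈ B → d ∉ B →
                 Adj a b → Adj b′ d → WalkAvoiding B a d 2

  module _ {B : Subset order} (bypass : Bypassable B) where

    reroute : ∀ {x y k} → x ∉ B → y ∉ B → Walk G x y k → WalkAvoiding B x y k
    -- The walk entered B from a through the edge a b and is now at c ∈ B.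
    reroute-inside : ∀ {a b c y k} → a ∉ B → Adj a b → b ∈ B → c ∈ B → y ∉ B →
                     Walk G c y k → WalkAvoiding B a y (suc k)
    reroute x∉ y∉ nil = 0 , z≤n , nil , tt
    reroute x∉ y∉ (cons {y = z} e w) with z ∈? B
    ... | yes z∈ = reroute-inside x∉ e z∈ z∈ y∉ w
    ... | no z∉ with reroute z∉ y∉ w
    ...   | k , k≤ , w′ , ni = suc k , s≤s k≤ , cons e w′ , noInternal-cons e w′ z∉ ni
    reroute-inside a∉ ab b∈ c∈ y∉ nil = ⊥-elim (y∉ c∈)
    reroute-inside a∉ ab b∈ c∈ y∉ (cons {y = d} e w) with d ∈? B
    ... | yes d∈ with reroute-inside a∉ ab b∈ d∈ y∉ w
    ...   | k , k≤ , w′ , ni = k , m≤n⇒m≤1+n k≤ , w′ , ni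
    reroute-inside a∉ ab b∈ c∈ y∉ (cons {y = d} e w) | no d∉
      with bypass a∉ b∈ c∈ d∉ ab e | reroute d∉ y∉ w
    ... | k , k≤ , v , niv | l , l≤ , w′ , niw =
      k + l , +-mono-≤ k≤ l≤ , v ++ʷ w′ , noInternal-++ v w′ niv d∉ niw

module DecidableGraph (G : Graph) (adj? : Decidable (Graph.Adj G)) where
  open Graph G using (order; Adj)
  open Walks G
  open Visibility G

  walk? : ∀ k x y → Dec (Walk G x y k)
  walk? zero x y with x ≟ y
  ... | yes refl = yes nil
  ... | no x≢y   = no λ { nil → x≢y refl }
  walk? (suc k) x y with any? (λ z → adj? x z ×-dec walk? k z y)
  ... | yes (z , e , w) = yes (cons e w)
  ... | no ¬w           = no λ { (cons e w) → ¬w (_ , e , w) }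

  NoWalkBelow : Fin order → Fin order → ℕ → Set
  NoWalkBelow x y n = ∀ j → j < n → ¬ Walk G x y j

  first-walk : ∀ x y n →
    (Σ ℕ λ d → Walk G x y d × NoWalkBelow x y d) ⊎ NoWalkBelow x y n
  first-walk x y zero = inj₂ λ j ()
  first-walk x y (suc n) with first-walk x y n
  ... | inj₁ found = inj₁ found
  ... | inj₂ none with walk? n x y
  ...   | yes w = inj₁ (n , w , none)
  ...   | no ¬w = inj₂ none′
    where
    none′ : NoWalkBelow x y (suc n)
    none′ j (s≤s j≤n) with m≤n⇒m<n∨m≡n j≤n
    ... | inj₁ j<n  = none j j<n
    ... | inj₂ refl = ¬w

  shortest : ∀ {x y k} → Walk G x y k → Σ ℕ λ d → Σ (Walk G x y d) (IsShortest G)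
  shortest {x} {y} {k} w with first-walk x y (suc k)
  ... | inj₁ (d , w′ , none) = d , w′ , λ m v → ≮⇒≥ λ m<d → none m m<d v
  ... | inj₂ none            = ⊥-elim (none k (n<1+n k) w)

  bypassable-clique⇒dmv : ∀ {B} → Connected G → Bypassable B →
    (∀ {x y} → x ∈ B → y ∈ B → x ≢ y → Adj x y) → DualMutualVisibility G B
  bypassable-clique⇒dmv {B} connected bypass clique = inside , outside
    where
    inside : ∀ x y → x ∈ B → y ∈ B → Visible G B x y
    inside x y x∈ y∈ with x ≟ y
    ... | yes refl = 0 , nil , (λ _ _ → z≤n) , tt
    ... | no x≢y   = 1 , cons (clique x∈ y∈ x≢y) nil , one≤ , tt
      where
      one≤ : ∀ m → Walk G x y m → 1 ≤ m
      one≤ zero    nil = ⊥-elim (x≢y refl)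
      one≤ (suc m) _   = s≤s z≤n
    outside : ∀ x y → x ∉ B → y ∉ B → Visible G B x y
    outside x y x∉ y∉ with shortest (proj₂ (connected x y))
    ... | d , w , w-shortest with reroute bypass x∉ y∉ w
    ...   | k , k≤d , w′ , ni = k , w′ , (λ m v → ≤-trans k≤d (w-shortest m v)) , ni

  ∅-dmv : Connected G → DualMutualVisibility G ∅
  ∅-dmv connected = bypassable-clique⇒dmv connected (λ _ b∈ → ⊥-elim (∉⊥ b∈)) (λ x∈ → ⊥-elim (∉⊥ x∈))

module Petersen where
  -- Outer 5-cycle 0 … 4, inner pentagram 5 … 9, spokes i — i + 5.
  neighbourTable : Vec (Vec (Fin 10) 3) 10
  neighbourTable =
    (# 1 ∷ # 4 ∷ # 5 ∷ []) ∷ (# 2 ∷ # 0 ∷ # 6 ∷ []) ∷ (# 3 ∷ # 1 ∷ # 7 ∷ []) ∷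
    (# 4 ∷ # 2 ∷ # 8 ∷ []) ∷ (# 0 ∷ # 3 ∷ # 9 ∷ []) ∷ (# 0 ∷ # 7 ∷ # 8 ∷ []) ∷
    (# 1 ∷ # 8 ∷ # 9 ∷ []) ∷ (# 2 ∷ # 9 ∷ # 5 ∷ []) ∷ (# 3 ∷ # 5 ∷ # 6 ∷ []) ∷
    (# 4 ∷ # 6 ∷ # 7 ∷ []) ∷ []

  neighbour : Fin 10 → Fin 3 → Fin 10
  neighbour x = Vec.lookup (Vec.lookup neighbourTable x)

  Adjacent : Fin 10 → Fin 10 → Set
  Adjacent x y = ∃ λ k → neighbour x k ≡ y

  adjacent? : Decidable Adjacent
  adjacent? x y = any? λ k → neighbour x k ≟ y

  -- Decided by evaluation. The proof terms are huge, so they are only ever passed to functions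
  -- and never scrutinised with `with`, which would make the type checker normalise them.
  adjacent-sym : ∀ {x y} → Adjacent x y → Adjacent y x
  adjacent-sym {x} {y} = toWitness {a? = all? λ x → all? λ y → adjacent? x y →-dec adjacent? y x} _ x y

  adjacent-irrefl : ∀ {x} → ¬ Adjacent x x
  adjacent-irrefl {x} = toWitness {a? = all? λ x → ¬? (adjacent? x x)} _ x

  private
    OnlyMiddle : Fin 10 → Fin 10 → Fin 10 → Set
    OnlyMiddle x y z = y ≢ z × ¬ Adjacent y z × (∀ m → Adjacent y m → Adjacent m z → m ≡ x)

    girth5 : ∀ x k l → k ≡ l ⊎ OnlyMiddle x (neighbour x k) (neighbour x l)
    girth5 = toWitness {a? = all? λ x → all? λ k → all? λ l → k ≟ l ⊎-dec
      (¬? (neighbour x k ≟ neighbour x l) ×-dec ¬? (adjacent? (neighbour x k) (neighbour x l)) ×-dec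
       all? λ m → adjacent? (neighbour x k) m →-dec adjacent? m (neighbour x l) →-dec m ≟ x)} _

  neighbours-uniqueMiddle : ∀ x k l → k ≢ l → UniqueMiddle Adjacent (neighbour x k) (neighbour x l) x
  neighbours-uniqueMiddle x k l k≢l = fromGirth5 (girth5 x k l)
    where
    fromGirth5 : k ≡ l ⊎ OnlyMiddle x (neighbour x k) (neighbour x l) →
                 UniqueMiddle Adjacent (neighbour x k) (neighbour x l) x
    fromGirth5 (inj₁ k≡l) = ⊥-elim (k≢l k≡l)
    fromGirth5 (inj₂ (distinct , nonadjacent , unique)) = record
      { distinct = distinct ; nonadjacent = nonadjacent
      ; toMiddle = adjacent-sym (k , refl) ; fromMiddle = l , refl ; unique = unique }

  distance≤2-to-0 : ∀ x → x ≡ zero ⊎ Adjacent x zero ⊎ ∃ λ m → Adjacent x m × Adjacent m zero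
  distance≤2-to-0 = toWitness {a? = all? λ x →
    x ≟ zero ⊎-dec adjacent? x zero ⊎-dec any? λ m → adjacent? x m ×-dec adjacent? m zero} _

data SplitView (m n : ℕ) : Fin (m + n) → Set where
  left  : ∀ p → SplitView m n (p ↑ˡ n)
  right : ∀ q → SplitView m n (m ↑ʳ q)

splitView : ∀ m n i → SplitView m n i
splitView m n i with splitAt m {n} i in eq
... | inj₁ p = subst (SplitView m n) (splitAt⁻¹-↑ˡ eq) (left p)
... | inj₂ q = subst (SplitView m n) (splitAt⁻¹-↑ʳ eq) (right q)

∈-++⁺ˡ : ∀ {m n} {u : Subset m} {v : Subset n} {p} → p ∈ u → (p ↑ˡ n) ∈ (u ++ v)
∈-++⁺ˡ here      = here
∈-++⁺ˡ (there p) = there (∈-++⁺ˡ p)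

∈-++⁻ˡ : ∀ {m n} (u : Subset m) {v : Subset n} {p} → (p ↑ˡ n) ∈ (u ++ v) → p ∈ u
∈-++⁻ˡ (_ ∷ u) {p = zero}  here      = here
∈-++⁻ˡ (_ ∷ u) {p = suc p} (there x) = there (∈-++⁻ˡ u x)

∈-++⁺ʳ : ∀ {m n} (u : Subset m) {v : Subset n} {q} → q ∈ v → (m ↑ʳ q) ∈ (u ++ v)
∈-++⁺ʳ []      x = x
∈-++⁺ʳ (_ ∷ u) x = there (∈-++⁺ʳ u x)

∈-++⁻ʳ : ∀ {m n} (u : Subset m) {v : Subset n} {q} → (m ↑ʳ q) ∈ (u ++ v) → q ∈ v
∈-++⁻ʳ []      x         = x
∈-++⁻ʳ (_ ∷ u) (there x) = ∈-++⁻ʳ u x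

∣++∣ : ∀ {m n} (u : Subset m) (v : Subset n) → ∣ u ++ v ∣ ≡ ∣ u ∣ + ∣ v ∣
∣++∣ []          v = refl
∣++∣ (true ∷ u)  v = cong suc (∣++∣ u v)
∣++∣ (false ∷ u) v = ∣++∣ u v

filter-map : ∀ {A B : Set} {p} {P : Unary.Pred B p} (P? : Unary.Decidable P) (f : A → B) xs →
             filter P? (map f xs) ≡ map f (filter (P? ∘ f) xs)
filter-map P? f []       = refl
filter-map P? f (x ∷ xs) with does (P? (f x))
... | true  = cong (f x ∷_) (filter-map P? f xs)
... | false = filter-map P? f xs

multiplicity : ℕ → List ℕ → ℕ
multiplicity s xs = length (filter (_≟ℕ s) xs)

positions : (xs : List ℕ) → ℕ → List (Fin (length xs))
positions xs s = filter (λ j → lookup xs j ≟ℕ s) (allFin (length xs))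

length-positions : ∀ xs s → length (positions xs s) ≡ multiplicity s xs
length-positions xs s = begin
  length (filter P? indices)                    ≡⟨ length-map (lookup xs) (filter P? indices) ⟨
  length (map (lookup xs) (filter P? indices))  ≡⟨ cong length (filter-map (_≟ℕ s) (lookup xs) indices) ⟨
  multiplicity s (map (lookup xs) indices)      ≡⟨ cong (multiplicity s) (map-tabulate id (lookup xs)) ⟩
  multiplicity s (List.tabulate (lookup xs))    ≡⟨ cong (multiplicity s) (tabulate-lookup xs) ⟩
  multiplicity s xs                             ∎
  where
  indices : List (Fin (length xs))
  indices = allFin (length xs)
  P? : ∀ j → Dec (lookup xs j ≡ s)
  P? = (_≟ℕ s) ∘ lookup xs
multiplicity-++ : ∀ s xs ys → multiplicity s (xs List.++ ys) ≡ multiplicity s xs + multiplicity s ys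
multiplicity-++ s xs ys = trans (cong length (filter-++ (_≟ℕ s) xs ys)) (length-++ (filter (_≟ℕ s) xs))

multiplicity-map-suc : ∀ s xs → multiplicity (suc s) (map suc xs) ≡ multiplicity s xs
multiplicity-map-suc s xs = begin
  length (filter (_≟ℕ suc s) (map suc xs))         ≡⟨ cong length (filter-map (_≟ℕ suc s) suc xs) ⟩
  length (map suc (filter ((_≟ℕ suc s) ∘ suc) xs)) ≡⟨ length-map suc (filter ((_≟ℕ suc s) ∘ suc) xs) ⟩
  length (filter ((_≟ℕ suc s) ∘ suc) xs)           ≡⟨ cong length (filter-≐ _ (_≟ℕ s) (suc-injective , cong suc) xs) ⟩
  multiplicity s xs                                ∎

-- Block sizes minus one: c₀ zeros, c₁ ones, c₂ twos, ...
blockSizes : List ℕ → List ℕ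
blockSizes []       = []
blockSizes (c ∷ cs) = replicate c 0 List.++ map suc (blockSizes cs)

multiplicity-blockSizes : ∀ cs s → multiplicity s (blockSizes cs) ≡ coeff cs s
multiplicity-blockSizes []       s       = refl
multiplicity-blockSizes (c ∷ cs) zero    = begin
  multiplicity 0 (replicate c 0 List.++ map suc rest)               ≡⟨ multiplicity-++ 0 (replicate c 0) _ ⟩
  multiplicity 0 (replicate c 0) + multiplicity 0 (map suc rest)    ≡⟨ cong₂ _+_ zeros none ⟩
  c + 0                                                             ≡⟨ +-identityʳ c ⟩
  c                                                                 ∎
  where
  rest : List ℕ
  rest = blockSizes cs
  zeros : multiplicity 0 (replicate c 0) ≡ c
  zeros = trans (cong length (filter-all (_≟ℕ 0) (All.replicate⁺ c refl))) (length-replicate c)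
  none : multiplicity 0 (map suc rest) ≡ 0
  none = cong length (filter-none (_≟ℕ 0) (All.map⁺ (universal (λ _ ()) rest)))
multiplicity-blockSizes (c ∷ cs) (suc s) = begin
  multiplicity (suc s) (replicate c 0 List.++ map suc rest)         ≡⟨ multiplicity-++ (suc s) (replicate c 0) _ ⟩
  multiplicity (suc s) (replicate c 0) + multiplicity (suc s) (map suc rest)
                                                                    ≡⟨ cong₂ _+_ none (multiplicity-map-suc s rest) ⟩
  multiplicity s rest                                               ≡⟨ multiplicity-blockSizes cs s ⟩
  coeff cs s                                                        ∎
  where
  rest : List ℕ
  rest = blockSizes cs
  none : multiplicity (suc s) (replicate c 0) ≡ 0
  none = cong length (filter-none (_≟ℕ suc s) (All.replicate⁺ c λ ()))

blockTotal : List ℕ → ℕ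
blockTotal []       = 0
blockTotal (k ∷ ks) = suc k + blockTotal ks

blockOf : ∀ ks → Fin (blockTotal ks) → Fin (length ks)
blockOf (k ∷ ks) p = [ (λ _ → zero) , (λ q → suc (blockOf ks q)) ]′ (splitAt (suc k) p)

blockOf-↑ˡ : ∀ k ks p → blockOf (k ∷ ks) (p ↑ˡ blockTotal ks) ≡ zero
blockOf-↑ˡ k ks p rewrite splitAt-↑ˡ (suc k) p (blockTotal ks) = refl

blockOf-↑ʳ : ∀ k ks q → blockOf (k ∷ ks) (suc k ↑ʳ q) ≡ suc (blockOf ks q)
blockOf-↑ʳ k ks q rewrite splitAt-↑ʳ (suc k) (blockTotal ks) q = refl

blockHead : ∀ ks → Fin (length ks) → Fin (blockTotal ks)
blockHead (k ∷ ks) zero    = zero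
blockHead (k ∷ ks) (suc j) = suc k ↑ʳ blockHead ks j

blockOf-head : ∀ ks j → blockOf ks (blockHead ks j) ≡ j
blockOf-head (k ∷ ks) zero    = refl
blockOf-head (k ∷ ks) (suc j) = trans (blockOf-↑ʳ k ks (blockHead ks j)) (cong suc (blockOf-head ks j))

blockIndicator : ∀ ks → Fin (length ks) → Subset (blockTotal ks)
blockIndicator (k ∷ ks) zero    = ⊤ {suc k} ++ ∅
blockIndicator (k ∷ ks) (suc j) = ∅ {suc k} ++ blockIndicator ks j

∈-blockIndicator⁺ : ∀ ks p → p ∈ blockIndicator ks (blockOf ks p)
∈-blockIndicator⁺ (k ∷ ks) p with splitView (suc k) (blockTotal ks) p
... | left p′ rewrite blockOf-↑ˡ k ks p′ = ∈-++⁺ˡ ∈⊤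
... | right q rewrite blockOf-↑ʳ k ks q = ∈-++⁺ʳ (∅ {suc k}) (∈-blockIndicator⁺ ks q)

∈-blockIndicator⁻ : ∀ ks j p → p ∈ blockIndicator ks j → blockOf ks p ≡ j
∈-blockIndicator⁻ (k ∷ ks) j p p∈ with splitView (suc k) (blockTotal ks) p | j
... | left p′ | zero  = blockOf-↑ˡ k ks p′
... | left p′ | suc j = ⊥-elim (∉⊥ (∈-++⁻ˡ (∅ {suc k}) p∈))
... | right q | zero  = ⊥-elim (∉⊥ (∈-++⁻ʳ (⊤ {suc k}) p∈))
... | right q | suc j =
  trans (blockOf-↑ʳ k ks q) (cong suc (∈-blockIndicator⁻ ks j q (∈-++⁻ʳ (∅ {suc k}) p∈)))

∣blockIndicator∣ : ∀ ks j → ∣ blockIndicator ks j ∣ ≡ suc (lookup ks j)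
∣blockIndicator∣ (k ∷ ks) zero = begin
  ∣ ⊤ {suc k} ++ ∅ ∣                    ≡⟨ ∣++∣ (⊤ {suc k}) ∅ ⟩
  ∣ ⊤ {suc k} ∣ + ∣ ∅ {blockTotal ks} ∣ ≡⟨ cong₂ _+_ (∣⊤∣≡n (suc k)) (∣⊥∣≡0 (blockTotal ks)) ⟩
  suc k + 0                             ≡⟨ +-identityʳ (suc k) ⟩
  suc k                                 ∎
∣blockIndicator∣ (k ∷ ks) (suc j) = begin
  ∣ ∅ {suc k} ++ blockIndicator ks j ∣    ≡⟨ ∣++∣ (∅ {suc k}) (blockIndicator ks j) ⟩
  ∣ ∅ {suc k} ∣ + ∣ blockIndicator ks j ∣ ≡⟨ cong₂ _+_ (∣⊥∣≡0 (suc k)) (∣blockIndicator∣ ks j) ⟩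
  suc (lookup ks j)                       ∎

module BlockGraph (ks : List ℕ) where

  Block BlockVertex : Set
  Block       = Fin (length ks)
  BlockVertex = Fin (blockTotal ks)

  data Anchor : Set where
    hub₁ hub₂ : Anchor
    tag       : BlockVertex → Anchor
    sepˡ sepʳ : Block → Block → Anchor

  data Vertex : Set where
    block    : BlockVertex → Vertex
    anchor   : Anchor → Vertex
    petersen : Anchor → Fin 3 → Fin 10 → Vertex

  Joins : Block → Block → Block → Set
  Joins j i i′ = j ≡ i ⊎ j ≡ i′

  data Edge : Vertex → Vertex → Set where
    block-block : ∀ {p p′} → blockOf ks p ≡ blockOf ks p′ → p ≢ p′ → Edge (block p) (block p′)
    block-tag   : ∀ {p} → Edge (block p) (anchor (tag p))
    block-sepˡ  : ∀ {p i i′} → i ≢ i′ → Joins (blockOf ks p) i i′ → Edge (block p) (anchor (sepˡ i i′))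
    block-sepʳ  : ∀ {p i i′} → i ≢ i′ → Joins (blockOf ks p) i i′ → Edge (block p) (anchor (sepʳ i i′))
    hub-hub     : Edge (anchor hub₁) (anchor hub₂)
    hub₁-tag    : ∀ {p} → Edge (anchor hub₁) (anchor (tag p))
    hub₁-sepˡ   : ∀ {i i′} → Edge (anchor hub₁) (anchor (sepˡ i i′))
    hub₂-tag    : ∀ {p} → Edge (anchor hub₂) (anchor (tag p))
    hub₂-sepʳ   : ∀ {i i′} → Edge (anchor hub₂) (anchor (sepʳ i i′))
    sepˡ-sepʳ   : ∀ {i i′ l l′} → i ≢ l ⊎ i′ ≢ l′ → Edge (anchor (sepˡ i i′)) (anchor (sepʳ l l′))
    anchor-petersen   : ∀ {a r} → Edge (anchor a) (petersen a r zero)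
    petersen-petersen : ∀ {a r x y} → Petersen.Adjacent x y → Edge (petersen a r x) (petersen a r y)

  Adjacent : Vertex → Vertex → Set
  Adjacent u v = Edge u v ⊎ Edge v u

  adjacent-sym : ∀ {u v} → Adjacent u v → Adjacent v u
  adjacent-sym (inj₁ e) = inj₂ e
  adjacent-sym (inj₂ e) = inj₁ e

  edge-irrefl : ∀ {u} → ¬ Edge u u
  edge-irrefl (block-block _ p≢p) = p≢p refl
  edge-irrefl (petersen-petersen a) = Petersen.adjacent-irrefl a

  adjacent-irrefl : ∀ {u} → ¬ Adjacent u u
  adjacent-irrefl (inj₁ e) = edge-irrefl e
  adjacent-irrefl (inj₂ e) = edge-irrefl e

  pairCount anchorCount gadgetCount order : ℕ
  pairCount   = length ks * length ks
  anchorCount = 2 + (blockTotal ks + (pairCount + pairCount))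
  gadgetCount = anchorCount * 31
  order       = blockTotal ks + gadgetCount

  anchorIndex : Anchor → Fin anchorCount
  anchorIndex hub₁        = zero
  anchorIndex hub₂        = suc zero
  anchorIndex (tag p)     = suc (suc (p ↑ˡ (pairCount + pairCount)))
  anchorIndex (sepˡ i i′) = suc (suc (blockTotal ks ↑ʳ (combine i i′ ↑ˡ pairCount)))
  anchorIndex (sepʳ i i′) = suc (suc (blockTotal ks ↑ʳ (pairCount ↑ʳ combine i i′)))

  anchorAt : Fin anchorCount → Anchor
  anchorAt zero          = hub₁
  anchorAt (suc zero)    = hub₂
  anchorAt (suc (suc i)) = [ tag , [ uncurry sepˡ ∘ remQuot _ , uncurry sepʳ ∘ remQuot _ ]′ ∘ splitAt pairCount ]′
                             (splitAt (blockTotal ks) i)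

  anchorAt-index : ∀ a → anchorAt (anchorIndex a) ≡ a
  anchorAt-index hub₁ = refl
  anchorAt-index hub₂ = refl
  anchorAt-index (tag p) rewrite splitAt-↑ˡ (blockTotal ks) p (pairCount + pairCount) = refl
  anchorAt-index (sepˡ i i′)
    rewrite splitAt-↑ʳ (blockTotal ks) (pairCount + pairCount) (combine i i′ ↑ˡ pairCount)
          | splitAt-↑ˡ pairCount (combine i i′) pairCount = cong (uncurry sepˡ) (remQuot-combine i i′)
  anchorAt-index (sepʳ i i′)
    rewrite splitAt-↑ʳ (blockTotal ks) (pairCount + pairCount) (pairCount ↑ʳ combine i i′)
          | splitAt-↑ʳ pairCount pairCount (combine i i′) = cong (uncurry sepʳ) (remQuot-combine i i′)

  anchorIndex-at : ∀ i → anchorIndex (anchorAt i) ≡ i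
  anchorIndex-at zero = refl
  anchorIndex-at (suc zero) = refl
  anchorIndex-at (suc (suc i)) with splitView (blockTotal ks) (pairCount + pairCount) i
  ... | left p rewrite splitAt-↑ˡ (blockTotal ks) p (pairCount + pairCount) = refl
  ... | right q rewrite splitAt-↑ʳ (blockTotal ks) (pairCount + pairCount) q with splitView pairCount pairCount q
  ...   | left c rewrite splitAt-↑ˡ pairCount c pairCount =
    cong (λ c → suc (suc (blockTotal ks ↑ʳ (c ↑ˡ pairCount)))) (combine-remQuot {length ks} (length ks) c)
  ...   | right c rewrite splitAt-↑ʳ pairCount pairCount c =
    cong (λ c → suc (suc (blockTotal ks ↑ʳ (pairCount ↑ʳ c)))) (combine-remQuot {length ks} (length ks) c)

  _≟ᴬ_ : Decidable {A = Anchor} _≡_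
  a ≟ᴬ b = map′ injective (cong anchorIndex) (anchorIndex a ≟ anchorIndex b)
    where
    injective : anchorIndex a ≡ anchorIndex b → a ≡ b
    injective e = trans (sym (anchorAt-index a)) (trans (cong anchorAt e) (anchorAt-index b))

  -- Gadget position (a , 0) is the anchor a, and (a , 1 + 10 r + x) is vertex x of its r-th Petersen copy.
  gadgetAt : Fin anchorCount → Fin 31 → Vertex
  gadgetAt a zero    = anchor (anchorAt a)
  gadgetAt a (suc t) = uncurry (petersen (anchorAt a)) (remQuot {3} 10 t)

  fromFin : Fin order → Vertex
  fromFin i = [ block , uncurry gadgetAt ∘ remQuot {anchorCount} 31 ]′ (splitAt (blockTotal ks) i)

  gadgetIndex : Fin anchorCount → Fin 31 → Fin order
  gadgetIndex a t = blockTotal ks ↑ʳ combine a t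

  toFin : Vertex → Fin order
  toFin (block p)        = p ↑ˡ gadgetCount
  toFin (anchor a)       = gadgetIndex (anchorIndex a) zero
  toFin (petersen a r x) = gadgetIndex (anchorIndex a) (suc (combine r x))

  fromFin-↑ʳ : ∀ q → fromFin (blockTotal ks ↑ʳ q) ≡ uncurry gadgetAt (remQuot {anchorCount} 31 q)
  fromFin-↑ʳ q = cong [ block , uncurry gadgetAt ∘ remQuot {anchorCount} 31 ]′ (splitAt-↑ʳ (blockTotal ks) gadgetCount q)

  fromFin-gadget : ∀ a t → fromFin (gadgetIndex a t) ≡ gadgetAt a t
  fromFin-gadget a t = trans (fromFin-↑ʳ (combine a t)) (cong (uncurry gadgetAt) (remQuot-combine a t))

  fromFin-toFin : ∀ v → fromFin (toFin v) ≡ v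
  fromFin-toFin (block p) = cong [ block , uncurry gadgetAt ∘ remQuot {anchorCount} 31 ]′ (splitAt-↑ˡ (blockTotal ks) p gadgetCount)
  fromFin-toFin (anchor a) = trans (fromFin-gadget (anchorIndex a) zero) (cong anchor (anchorAt-index a))
  fromFin-toFin (petersen a r x) = trans (fromFin-gadget (anchorIndex a) (suc (combine r x)))
    (cong₂ (λ a → uncurry (petersen a)) (anchorAt-index a) (remQuot-combine r x))

  toFin-gadgetAt : ∀ a t → toFin (gadgetAt a t) ≡ gadgetIndex a t
  toFin-gadgetAt a zero    = cong (λ a → gadgetIndex a zero) (anchorIndex-at a)
  toFin-gadgetAt a (suc t) = cong₂ (λ a t → gadgetIndex a (suc t)) (anchorIndex-at a) (combine-remQuot {3} 10 t)

  toFin-fromFin : ∀ i → toFin (fromFin i) ≡ i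
  toFin-fromFin i with splitView (blockTotal ks) gadgetCount i
  ... | left p = cong toFin (fromFin-toFin (block p))
  ... | right q = begin
    toFin (fromFin (blockTotal ks ↑ʳ q))      ≡⟨ cong toFin (fromFin-↑ʳ q) ⟩
    toFin (uncurry gadgetAt aq)               ≡⟨ toFin-gadgetAt (proj₁ aq) (proj₂ aq) ⟩
    blockTotal ks ↑ʳ uncurry combine aq       ≡⟨ cong (blockTotal ks ↑ʳ_) (combine-remQuot {anchorCount} 31 q) ⟩
    blockTotal ks ↑ʳ q                        ∎
    where
    aq : Fin anchorCount × Fin 31
    aq = remQuot {anchorCount} 31 q

  toFin-injective : ∀ {u v} → toFin u ≡ toFin v → u ≡ v
  toFin-injective {u} {v} e = trans (sym (fromFin-toFin u)) (trans (cong fromFin e) (fromFin-toFin v))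

  joins? : ∀ p i i′ → Dec (Joins (blockOf ks p) i i′)
  joins? p i i′ = blockOf ks p ≟ i ⊎-dec blockOf ks p ≟ i′

  edge? : Decidable Edge
  edge? (block p) (block p′) with blockOf ks p ≟ blockOf ks p′ | p ≟ p′
  ... | yes same | no p≢p′ = yes (block-block same p≢p′)
  ... | no other | _       = no λ { (block-block same _) → other same }
  ... | _        | yes refl = no edge-irrefl
  edge? (block p) (anchor hub₁) = no λ ()
  edge? (block p) (anchor hub₂) = no λ ()
  edge? (block p) (anchor (tag p′)) with p ≟ p′
  ... | yes refl = yes block-tag
  ... | no p≢p′  = no λ { block-tag → p≢p′ refl }
  edge? (block p) (anchor (sepˡ i i′)) with ¬? (i ≟ i′) | joins? p i i′
  ... | yes i≢i′ | yes j = yes (block-sepˡ i≢i′ j)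
  ... | no ¬i≢i′ | _     = no λ { (block-sepˡ i≢i′ _) → ¬i≢i′ i≢i′ }
  ... | _        | no ¬j = no λ { (block-sepˡ _ j) → ¬j j }
  edge? (block p) (anchor (sepʳ i i′)) with ¬? (i ≟ i′) | joins? p i i′
  ... | yes i≢i′ | yes j = yes (block-sepʳ i≢i′ j)
  ... | no ¬i≢i′ | _     = no λ { (block-sepʳ i≢i′ _) → ¬i≢i′ i≢i′ }
  ... | _        | no ¬j = no λ { (block-sepʳ _ j) → ¬j j }
  edge? (block _) (petersen _ _ _) = no λ ()
  edge? (anchor _) (block _) = no λ ()
  edge? (anchor hub₁) (anchor hub₁) = no λ ()
  edge? (anchor hub₁) (anchor hub₂) = yes hub-hub
  edge? (anchor hub₁) (anchor (tag _)) = yes hub₁-tag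
  edge? (anchor hub₁) (anchor (sepˡ _ _)) = yes hub₁-sepˡ
  edge? (anchor hub₁) (anchor (sepʳ _ _)) = no λ ()
  edge? (anchor hub₂) (anchor hub₁) = no λ ()
  edge? (anchor hub₂) (anchor hub₂) = no λ ()
  edge? (anchor hub₂) (anchor (tag _)) = yes hub₂-tag
  edge? (anchor hub₂) (anchor (sepˡ _ _)) = no λ ()
  edge? (anchor hub₂) (anchor (sepʳ _ _)) = yes hub₂-sepʳ
  edge? (anchor (tag _)) (anchor _) = no λ ()
  edge? (anchor (sepˡ _ _)) (anchor hub₁) = no λ ()
  edge? (anchor (sepˡ _ _)) (anchor hub₂) = no λ ()
  edge? (anchor (sepˡ _ _)) (anchor (tag _)) = no λ ()
  edge? (anchor (sepˡ _ _)) (anchor (sepˡ _ _)) = no λ ()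
  edge? (anchor (sepˡ i i′)) (anchor (sepʳ l l′)) with ¬? (i ≟ l) ⊎-dec ¬? (i′ ≟ l′)
  ... | yes differ = yes (sepˡ-sepʳ differ)
  ... | no same    = no λ { (sepˡ-sepʳ differ) → same differ }
  edge? (anchor (sepʳ _ _)) (anchor _) = no λ ()
  edge? (anchor a) (petersen a′ r x) with a ≟ᴬ a′ | x ≟ zero
  ... | yes refl | yes refl = yes anchor-petersen
  ... | no a≢a′  | _        = no λ { anchor-petersen → a≢a′ refl }
  ... | _        | no x≢0   = no λ { anchor-petersen → x≢0 refl }
  edge? (petersen _ _ _) (block _) = no λ ()
  edge? (petersen _ _ _) (anchor _) = no λ ()
  edge? (petersen a r x) (petersen a′ r′ y) with a ≟ᴬ a′ | r ≟ r′ | Petersen.adjacent? x y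
  ... | yes refl | yes refl | yes xy = yes (petersen-petersen xy)
  ... | no a≢a′  | _        | _      = no λ { (petersen-petersen _) → a≢a′ refl }
  ... | _        | no r≢r′  | _      = no λ { (petersen-petersen _) → r≢r′ refl }
  ... | _        | _        | no ¬xy = no λ { (petersen-petersen xy) → ¬xy xy }

  G : Graph
  G = record
    { order  = order
    ; Adj    = λ i j → Adjacent (fromFin i) (fromFin j)
    ; sym    = adjacent-sym
    ; irrefl = adjacent-irrefl
    }

  adj? : Decidable (Graph.Adj G)
  adj? i j = edge? (fromFin i) (fromFin j) ⊎-dec edge? (fromFin j) (fromFin i)

  open Graph G using (Adj)
  open Walks G
  open Visibility G
  open DecidableGraph G adj?

  adj⁺ : ∀ {u v} → Adjacent u v → Adj (toFin u) (toFin v)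
  adj⁺ {u} {v} = subst₂ Adjacent (sym (fromFin-toFin u)) (sym (fromFin-toFin v))

  adjˡ⁺ : ∀ {u i} → Adjacent u (fromFin i) → Adj (toFin u) i
  adjˡ⁺ {u} = subst (λ w → Adjacent w _) (sym (fromFin-toFin u))

  adjʳ⁺ : ∀ {i u} → Adjacent (fromFin i) u → Adj i (toFin u)
  adjʳ⁺ {u = u} = subst (Adjacent _) (sym (fromFin-toFin u))

  adjˡ⁻ : ∀ {u i} → Adj (toFin u) i → Adjacent u (fromFin i)
  adjˡ⁻ {u} = subst (λ w → Adjacent w _) (fromFin-toFin u)

  adjʳ⁻ : ∀ {i u} → Adj i (toFin u) → Adjacent (fromFin i) u
  adjʳ⁻ {u = u} = subst (Adjacent _) (fromFin-toFin u)

  uniqueMiddle⁺ : ∀ {u v w} → UniqueMiddle Adjacent u v w → UniqueMiddle Adj (toFin u) (toFin v) (toFin w)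
  uniqueMiddle⁺ {u} {v} {w} um = record
    { distinct    = λ e → distinct (toFin-injective e)
    ; nonadjacent = λ e → nonadjacent (subst₂ Adjacent (fromFin-toFin u) (fromFin-toFin v) e)
    ; toMiddle    = adj⁺ toMiddle
    ; fromMiddle  = adj⁺ fromMiddle
    ; unique      = λ m e e′ → trans (sym (toFin-fromFin m)) (cong toFin (unique (fromFin m) (adjˡ⁻ e) (adjʳ⁻ e′)))
    }
    where open UniqueMiddle um

  anchor-uniqueMiddle : ∀ {a r r′} → r ≢ r′ →
    UniqueMiddle Adjacent (petersen a r zero) (petersen a r′ zero) (anchor a)
  anchor-uniqueMiddle {a} {r} {r′} r≢r′ = record
    { distinct    = λ { refl → r≢r′ refl }
    ; nonadjacent = λ { (inj₁ (petersen-petersen _)) → r≢r′ refl ; (inj₂ (petersen-petersen _)) → r≢r′ refl }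
    ; toMiddle    = inj₂ anchor-petersen
    ; fromMiddle  = inj₁ anchor-petersen
    ; unique      = unique
    }
    where
    unique : ∀ m → Adjacent (petersen a r zero) m → Adjacent m (petersen a r′ zero) → m ≡ anchor a
    unique _ (inj₂ anchor-petersen)         _                              = refl
    unique _ (inj₁ (petersen-petersen _)) (inj₁ (petersen-petersen _)) = ⊥-elim (r≢r′ refl)
    unique _ (inj₁ (petersen-petersen _)) (inj₂ (petersen-petersen _)) = ⊥-elim (r≢r′ refl)
    unique _ (inj₂ (petersen-petersen _)) (inj₁ (petersen-petersen _)) = ⊥-elim (r≢r′ refl)
    unique _ (inj₂ (petersen-petersen _)) (inj₂ (petersen-petersen _)) = ⊥-elim (r≢r′ refl)

  petersen-uniqueMiddle : ∀ {a r x y z} → UniqueMiddle Petersen.Adjacent y z x →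
    UniqueMiddle Adjacent (petersen a r y) (petersen a r z) (petersen a r x)
  petersen-uniqueMiddle {a} {r} {x} {y} {z} um = record
    { distinct    = λ { refl → distinct refl }
    ; nonadjacent = λ { (inj₁ (petersen-petersen e)) → nonadjacent e
                      ; (inj₂ (petersen-petersen e)) → nonadjacent (Petersen.adjacent-sym e) }
    ; toMiddle    = inj₁ (petersen-petersen toMiddle)
    ; fromMiddle  = inj₁ (petersen-petersen fromMiddle)
    ; unique      = unique′
    }
    where
    open UniqueMiddle um
    unique′ : ∀ m → Adjacent (petersen a r y) m → Adjacent m (petersen a r z) → m ≡ petersen a r x
    unique′ _ (inj₁ (petersen-petersen e)) (inj₁ (petersen-petersen e′)) = cong (petersen a r) (unique _ e e′)
    unique′ _ (inj₁ (petersen-petersen e)) (inj₂ (petersen-petersen e′)) =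
      cong (petersen a r) (unique _ e (Petersen.adjacent-sym e′))
    unique′ _ (inj₂ (petersen-petersen e)) (inj₁ (petersen-petersen e′)) =
      cong (petersen a r) (unique _ (Petersen.adjacent-sym e) e′)
    unique′ _ (inj₂ (petersen-petersen e)) (inj₂ (petersen-petersen e′)) =
      cong (petersen a r) (unique _ (Petersen.adjacent-sym e) (Petersen.adjacent-sym e′))
    unique′ _ (inj₂ anchor-petersen) (inj₁ anchor-petersen) = ⊥-elim (distinct refl)

  tag-uniqueMiddle : ∀ {p p′} → blockOf ks p ≡ blockOf ks p′ → p ≢ p′ →
    UniqueMiddle Adjacent (block p′) (anchor (tag p)) (block p)
  tag-uniqueMiddle {p} {p′} same p≢p′ = record
    { distinct    = λ ()
    ; nonadjacent = λ { (inj₁ block-tag) → p≢p′ refl }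
    ; toMiddle    = inj₂ (block-block same p≢p′)
    ; fromMiddle  = inj₁ block-tag
    ; unique      = unique
    }
    where
    unique : ∀ m → Adjacent (block p′) m → Adjacent m (anchor (tag p)) → m ≡ block p
    unique _ _ (inj₁ block-tag) = refl
    unique _ (inj₁ ()) (inj₁ hub₁-tag)
    unique _ (inj₂ ()) (inj₁ hub₁-tag)
    unique _ (inj₁ ()) (inj₁ hub₂-tag)
    unique _ (inj₂ ()) (inj₁ hub₂-tag)
    unique _ (inj₁ ()) (inj₂ anchor-petersen)
    unique _ (inj₂ ()) (inj₂ anchor-petersen)

  sep-common-neighbour : ∀ {i i′ v} → Adjacent (anchor (sepˡ i i′)) v → Adjacent v (anchor (sepʳ i i′)) →
    ∃ λ p → v ≡ block p × Joins (blockOf ks p) i i′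
  sep-common-neighbour (inj₂ (block-sepˡ _ j)) _ = _ , refl , j
  sep-common-neighbour (inj₂ hub₁-sepˡ) (inj₁ ())
  sep-common-neighbour (inj₂ hub₁-sepˡ) (inj₂ ())
  sep-common-neighbour (inj₁ (sepˡ-sepʳ _)) (inj₁ ())
  sep-common-neighbour (inj₁ (sepˡ-sepʳ _)) (inj₂ ())
  sep-common-neighbour (inj₁ anchor-petersen) (inj₁ ())
  sep-common-neighbour (inj₁ anchor-petersen) (inj₂ ())

  blockSet : Block → Subset order
  blockSet j = blockIndicator ks j ++ ∅

  ∈-blockSet⁺ : ∀ {j p} → blockOf ks p ≡ j → toFin (block p) ∈ blockSet j
  ∈-blockSet⁺ {p = p} refl = ∈-++⁺ˡ (∈-blockIndicator⁺ ks p)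

  ∈-blockSet⁻ : ∀ {j i} → i ∈ blockSet j → ∃ λ p → toFin (block p) ≡ i × blockOf ks p ≡ j
  ∈-blockSet⁻ {j} {i} i∈ with splitView (blockTotal ks) gadgetCount i
  ... | left p  = p , refl , ∈-blockIndicator⁻ ks j p (∈-++⁻ˡ (blockIndicator ks j) i∈)
  ... | right q = ⊥-elim (∉⊥ (∈-++⁻ʳ (blockIndicator ks j) i∈))

  ∣blockSet∣ : ∀ j → ∣ blockSet j ∣ ≡ suc (lookup ks j)
  ∣blockSet∣ j = begin
    ∣ blockIndicator ks j ++ ∅ ∣                  ≡⟨ ∣++∣ (blockIndicator ks j) ∅ ⟩
    ∣ blockIndicator ks j ∣ + ∣ ∅ {gadgetCount} ∣ ≡⟨ cong₂ _+_ (∣blockIndicator∣ ks j) (∣⊥∣≡0 gadgetCount) ⟩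
    suc (lookup ks j) + 0                         ≡⟨ +-identityʳ _ ⟩
    suc (lookup ks j)                             ∎

  blockSet-injective : ∀ {j j′} → blockSet j ≡ blockSet j′ → j ≡ j′
  blockSet-injective {j} {j′} e = trans (sym (blockOf-head ks j))
    (∈-blockIndicator⁻ ks j′ (blockHead ks j) (∈-++⁻ˡ (blockIndicator ks j′) head∈))
    where
    head∈ : toFin (block (blockHead ks j)) ∈ blockSet j′
    head∈ = subst (_ ∈_) e (∈-blockSet⁺ (blockOf-head ks j))

  module _ {X : Subset order} (dmv : DualMutualVisibility G X) where

    anchor∉ : ∀ a → toFin (anchor a) ∉ X
    anchor∉ a = triangle-centre∉ dmv (around {zero} {suc zero} (λ ())) (around {suc zero} {suc (suc zero)} (λ ()))
                                    (around {zero} {suc (suc zero)} (λ ()))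
      where
      around : ∀ {r r′} → r ≢ r′ → UniqueMiddle Adj (toFin (petersen a r zero)) (toFin (petersen a r′ zero)) (toFin (anchor a))
      around {r} {r′} r≢r′ = uniqueMiddle⁺ (anchor-uniqueMiddle {a} {r} {r′} r≢r′)

    petersen∉ : ∀ a r x → toFin (petersen a r x) ∉ X
    petersen∉ a r x = triangle-centre∉ dmv (around {zero} {suc zero} (λ ())) (around {suc zero} {suc (suc zero)} (λ ()))
                                           (around {zero} {suc (suc zero)} (λ ()))
      where
      around : ∀ {k l} → k ≢ l → UniqueMiddle Adj (toFin (petersen a r (Petersen.neighbour x k)))
                                                  (toFin (petersen a r (Petersen.neighbour x l))) (toFin (petersen a r x))
      around {k} {l} k≢l = uniqueMiddle⁺ (petersen-uniqueMiddle {a} {r} (Petersen.neighbours-uniqueMiddle x k l k≢l))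

    ∈⇒block : ∀ {i} → i ∈ X → ∃ λ p → toFin (block p) ≡ i
    ∈⇒block {i} i∈ = classify (fromFin i) (toFin-fromFin i)
      where
      classify : ∀ v → toFin v ≡ i → ∃ λ p → toFin (block p) ≡ i
      classify (block p)        e = p , e
      classify (anchor a)       e = ⊥-elim (anchor∉ a (subst (_∈ X) (sym e) i∈))
      classify (petersen a r x) e = ⊥-elim (petersen∉ a r x (subst (_∈ X) (sym e) i∈))

    block-closed : ∀ {p p′} → toFin (block p) ∈ X → blockOf ks p ≡ blockOf ks p′ → toFin (block p′) ∈ X
    block-closed {p} {p′} p∈ same with toFin (block p′) ∈? X | p ≟ p′
    ... | yes p′∈ | _        = p′∈
    ... | no p′∉  | yes refl = ⊥-elim (p′∉ p∈)
    ... | no p′∉  | no p≢p′  = ⊥-elim (blocked⇒¬sameSide dmv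
          (uniqueMiddle⇒blocked (uniqueMiddle⁺ (tag-uniqueMiddle same p≢p′)) p∈) (inj₂ (p′∉ , anchor∉ (tag p))))

    -- Were X to meet blocks i ≠ j, it would contain both, hence every common neighbour of the
    -- non-adjacent anchors sepˡ i j and sepʳ i j, which lie outside X.
    single-block : ∀ {p p′} → toFin (block p) ∈ X → toFin (block p′) ∈ X → blockOf ks p ≡ blockOf ks p′
    single-block {p} {p′} p∈ p′∈ with blockOf ks p ≟ blockOf ks p′
    ... | yes same = same
    ... | no i≢j   = ⊥-elim (blocked⇒¬sameSide dmv blocked (inj₂ (anchor∉ (sepˡ i j) , anchor∉ (sepʳ i j))))
      where
      i j : Block
      i = blockOf ks p
      j = blockOf ks p′
      middles∈ : ∀ m → Adj (toFin (anchor (sepˡ i j))) m → Adj m (toFin (anchor (sepʳ i j))) → m ∈ X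
      middles∈ m e e′ with sep-common-neighbour (adjˡ⁻ e) (adjʳ⁻ e′)
      ... | q , mq , inj₁ q∈i = subst (_∈ X) (trans (cong toFin (sym mq)) (toFin-fromFin m)) (block-closed p∈ (sym q∈i))
      ... | q , mq , inj₂ q∈j = subst (_∈ X) (trans (cong toFin (sym mq)) (toFin-fromFin m)) (block-closed p′∈ (sym q∈j))
      blocked : Blocked X (toFin (anchor (sepˡ i j))) (toFin (anchor (sepʳ i j)))
      blocked = record
        { distinct    = λ e → sepˡ≢sepʳ (toFin-injective e)
        ; nonadjacent = λ e → nonadj (subst₂ Adjacent (fromFin-toFin _) (fromFin-toFin _) e)
        ; middle      = toFin (block (blockHead ks i))
        ; toMiddle    = adj⁺ (inj₂ (block-sepˡ i≢j (inj₁ (blockOf-head ks i))))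
        ; fromMiddle  = adj⁺ (inj₁ (block-sepʳ i≢j (inj₁ (blockOf-head ks i))))
        ; middles∈    = middles∈
        }
        where
        sepˡ≢sepʳ : anchor (sepˡ i j) ≢ anchor (sepʳ i j)
        sepˡ≢sepʳ ()
        nonadj : ¬ Adjacent (anchor (sepˡ i j)) (anchor (sepʳ i j))
        nonadj (inj₁ (sepˡ-sepʳ (inj₁ i≢i))) = i≢i refl
        nonadj (inj₁ (sepˡ-sepʳ (inj₂ j≢j))) = j≢j refl

    dmv-classification : X ≡ ∅ ⊎ ∃ λ j → X ≡ blockSet j
    dmv-classification with nonempty? X
    ... | no empty = inj₁ (Empty-unique empty)
    ... | yes (i , i∈) with ∈⇒block i∈
    ...   | p , refl = inj₂ (blockOf ks p , ⊆-antisym X⊆ ⊆X)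
      where
      X⊆ : X ⊆ blockSet (blockOf ks p)
      X⊆ k∈ with ∈⇒block k∈
      ... | q , refl = ∈-blockSet⁺ (sym (single-block i∈ k∈))
      ⊆X : blockSet (blockOf ks p) ⊆ X
      ⊆X k∈ with ∈-blockSet⁻ k∈
      ... | q , refl , same = block-closed i∈ (sym same)

  InBlock : Block → Vertex → Set
  InBlock j (block p) = blockOf ks p ≡ j
  InBlock j _         = ⊥

  inBlock⇒toFin∈ : ∀ {j} v → InBlock j v → toFin v ∈ blockSet j
  inBlock⇒toFin∈ (block p) same = ∈-blockSet⁺ same

  toFin∈⇒inBlock : ∀ {j} v → toFin v ∈ blockSet j → InBlock j v
  toFin∈⇒inBlock {j} v v∈ with ∈-blockSet⁻ v∈
  ... | p , e , same = subst (InBlock j) (toFin-injective e) same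

  data Exit (p : BlockVertex) : Vertex → Set where
    via-tag  : Exit p (anchor (tag p))
    via-sepˡ : ∀ {i i′} → i ≢ i′ → Joins (blockOf ks p) i i′ → Exit p (anchor (sepˡ i i′))
    via-sepʳ : ∀ {i i′} → i ≢ i′ → Joins (blockOf ks p) i i′ → Exit p (anchor (sepʳ i i′))

  exit : ∀ {p v} → Adjacent (block p) v → ¬ InBlock (blockOf ks p) v → Exit p v
  exit (inj₁ (block-block same _)) out = ⊥-elim (out (sym same))
  exit (inj₁ block-tag)            _   = via-tag
  exit (inj₁ (block-sepˡ i≢i′ j))  _   = via-sepˡ i≢i′ j
  exit (inj₁ (block-sepʳ i≢i′ j))  _   = via-sepʳ i≢i′ j
  exit (inj₂ (block-block same _)) out = ⊥-elim (out same)

  Detour : Block → Vertex → Vertex → Set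
  Detour j u v = Adjacent u v ⊎ ∃ λ w → ¬ InBlock j w × Adjacent u w × Adjacent w v

  through : ∀ {j u v} a → Adjacent u (anchor a) → Adjacent (anchor a) v → Detour j u v
  through a e e′ = inj₂ (anchor a , (λ ()) , e , e′)

  other-endpoint : ∀ {j i i′} → i ≢ i′ → Joins j i i′ → ∃ λ o → o ≢ j × Joins o i i′
  other-endpoint i≢i′ (inj₁ refl) = _ , (λ { refl → i≢i′ refl }) , inj₂ refl
  other-endpoint i≢i′ (inj₂ refl) = _ , (λ { refl → i≢i′ refl }) , inj₁ refl

  -- The separators of {i, i′} are joined only through blocks i and i′; leaving block j, use the other one.
  across : ∀ {j i i′} → i ≢ i′ → Joins j i i′ → Detour j (anchor (sepˡ i i′)) (anchor (sepʳ i i′))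
  across {j} i≢i′ joins with other-endpoint i≢i′ joins
  ... | o , o≢j , o-joins = inj₂ (block (blockHead ks o) , (λ same → o≢j (trans (sym (blockOf-head ks o)) same)) ,
          inj₂ (block-sepˡ i≢i′ head-joins) , inj₁ (block-sepʳ i≢i′ head-joins))
    where
    head-joins : Joins (blockOf ks (blockHead ks o)) _ _
    head-joins = subst (λ b → Joins b _ _) (sym (blockOf-head ks o)) o-joins

  detour-sym : ∀ {j u v} → Detour j u v → Detour j v u
  detour-sym (inj₁ e)                 = inj₁ (adjacent-sym e)
  detour-sym (inj₂ (w , w∉ , e , e′)) = inj₂ (w , w∉ , adjacent-sym e′ , adjacent-sym e)

  detour : ∀ {p p′ u v} → Exit p u → Exit p′ v → Detour (blockOf ks p) u v
  detour via-tag        via-tag        = through hub₁ (inj₂ hub₁-tag) (inj₁ hub₁-tag)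
  detour via-tag        (via-sepˡ _ _) = through hub₁ (inj₂ hub₁-tag) (inj₁ hub₁-sepˡ)
  detour via-tag        (via-sepʳ _ _) = through hub₂ (inj₂ hub₂-tag) (inj₁ hub₂-sepʳ)
  detour (via-sepˡ _ _) via-tag        = through hub₁ (inj₂ hub₁-sepˡ) (inj₁ hub₁-tag)
  detour (via-sepʳ _ _) via-tag        = through hub₂ (inj₂ hub₂-sepʳ) (inj₁ hub₂-tag)
  detour (via-sepˡ _ _) (via-sepˡ _ _) = through hub₁ (inj₂ hub₁-sepˡ) (inj₁ hub₁-sepˡ)
  detour (via-sepʳ _ _) (via-sepʳ _ _) = through hub₂ (inj₂ hub₂-sepʳ) (inj₁ hub₂-sepʳ)
  detour (via-sepˡ {i} {i′} i≢i′ joins) (via-sepʳ {l} {l′} _ _) with i ≟ l | i′ ≟ l′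
  ... | yes refl | yes refl = across i≢i′ joins
  ... | no i≢l   | _        = inj₁ (inj₁ (sepˡ-sepʳ (inj₁ i≢l)))
  ... | _        | no i′≢l′ = inj₁ (inj₁ (sepˡ-sepʳ (inj₂ i′≢l′)))
  detour (via-sepʳ {i} {i′} i≢i′ joins) (via-sepˡ {l} {l′} _ _) with l ≟ i | l′ ≟ i′
  ... | yes refl | yes refl = detour-sym (across i≢i′ joins)
  ... | no l≢i   | _        = inj₁ (inj₂ (sepˡ-sepʳ (inj₁ l≢i)))
  ... | _        | no l′≢i′ = inj₁ (inj₂ (sepˡ-sepʳ (inj₂ l′≢i′)))

  blockSet-bypassable : ∀ j → Bypassable (blockSet j)
  blockSet-bypassable j {a} {d = d} a∉ b∈ b′∈ d∉ ab b′d with ∈-blockSet⁻ b∈ | ∈-blockSet⁻ b′∈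
  ... | p , refl , refl | p′ , refl , same =
    toWalk (detour (exit (adjacent-sym (adjʳ⁻ ab)) (outside a∉)) (exit (adjˡ⁻ b′d) (outside′ d∉)))
    where
    outside : ∀ {i} → i ∉ blockSet (blockOf ks p) → ¬ InBlock (blockOf ks p) (fromFin i)
    outside {i} i∉ inB = i∉ (subst (_∈ blockSet _) (toFin-fromFin i) (inBlock⇒toFin∈ (fromFin i) inB))
    outside′ : ∀ {i} → i ∉ blockSet (blockOf ks p) → ¬ InBlock (blockOf ks p′) (fromFin i)
    outside′ i∉ inB = outside i∉ (subst (λ b → InBlock b _) same inB)
    toWalk : Detour (blockOf ks p) (fromFin a) (fromFin d) → WalkAvoiding (blockSet (blockOf ks p)) a d 2
    toWalk (inj₁ e) = 1 , s≤s z≤n , cons e nil , tt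
    toWalk (inj₂ (w , w∉ , e , e′)) =
      2 , ≤-refl , cons (adjʳ⁺ e) (cons (adjˡ⁺ e′) nil) , (λ w∈ → w∉ (toFin∈⇒inBlock w w∈)) , tt

  blockSet-clique : ∀ j {x y} → x ∈ blockSet j → y ∈ blockSet j → x ≢ y → Adj x y
  blockSet-clique j x∈ y∈ x≢y with ∈-blockSet⁻ x∈ | ∈-blockSet⁻ y∈
  ... | p , refl , same | p′ , refl , same′ =
    adj⁺ (inj₁ (block-block (trans same (sym same′)) λ { refl → x≢y refl }))

  record ReachesHub (v : Vertex) : Set where
    constructor reaching
    field
      {steps} : ℕ
      walk    : Walk G (toFin v) (toFin (anchor hub₁)) steps

  infixr 5 _◅_
  _◅_ : ∀ {u v} → Adjacent u v → ReachesHub v → ReachesHub u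
  e ◅ reaching w = reaching (cons (adj⁺ e) w)

  anchor-reaches : ∀ a → ReachesHub (anchor a)
  anchor-reaches hub₁       = reaching nil
  anchor-reaches hub₂       = inj₂ hub-hub ◅ anchor-reaches hub₁
  anchor-reaches (tag _)    = inj₂ hub₁-tag ◅ anchor-reaches hub₁
  anchor-reaches (sepˡ _ _) = inj₂ hub₁-sepˡ ◅ anchor-reaches hub₁
  anchor-reaches (sepʳ _ _) = inj₂ hub₂-sepʳ ◅ inj₂ hub-hub ◅ anchor-reaches hub₁

  petersen-reaches : ∀ a r x → ReachesHub (petersen a r x)
  petersen-reaches a r x = via-root (Petersen.distance≤2-to-0 x)
    where
    root : ReachesHub (petersen a r zero)
    root = inj₂ anchor-petersen ◅ anchor-reaches a
    via-root : x ≡ zero ⊎ Petersen.Adjacent x zero ⊎ ∃ (λ m → Petersen.Adjacent x m × Petersen.Adjacent m zero) →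
               ReachesHub (petersen a r x)
    via-root (inj₁ refl)                = root
    via-root (inj₂ (inj₁ e))            = inj₁ (petersen-petersen e) ◅ root
    via-root (inj₂ (inj₂ (m , e , e′))) = inj₁ (petersen-petersen {y = m} e) ◅ inj₁ (petersen-petersen e′) ◅ root

  reaches : ∀ v → ReachesHub v
  reaches (block p)        = inj₁ block-tag ◅ anchor-reaches (tag p)
  reaches (anchor a)       = anchor-reaches a
  reaches (petersen a r x) = petersen-reaches a r x

  connected : Connected G
  connected = connected-via (toFin (anchor hub₁)) λ i →
    subst (λ i → ∃ λ k → Walk G i _ k) (toFin-fromFin i) (_ , ReachesHub.walk (reaches (fromFin i)))

  blockSet-dmv : ∀ j → DualMutualVisibility G (blockSet j)
  blockSet-dmv j = bypassable-clique⇒dmv connected (blockSet-bypassable j) (blockSet-clique j)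

  dualVisCoeff-zero : DualVisCoeff G 0 1
  dualVisCoeff-zero = ∅ ∷ [] , [] ∷ [] , (λ X → mk⇔ (sound X) (complete X)) , refl
    where
    sound : ∀ X → X ∈ₗ ∅ ∷ [] → DualMutualVisibility G X × ∣ X ∣ ≡ 0
    sound X (here refl) = ∅-dmv connected , ∣⊥∣≡0 order
    complete : ∀ X → DualMutualVisibility G X × ∣ X ∣ ≡ 0 → X ∈ₗ ∅ ∷ []
    complete X (dmv , size) with dmv-classification dmv
    ... | inj₁ X≡∅      = here X≡∅
    ... | inj₂ (j , refl) with trans (sym (∣blockSet∣ j)) size
    ...   | ()

  dualVisCoeff-suc : ∀ s → DualVisCoeff G (suc s) (multiplicity s ks)
  dualVisCoeff-suc s = map blockSet (positions ks s) , unique , (λ X → mk⇔ (sound X) (complete X)) , size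
    where
    unique : Unique (map blockSet (positions ks s))
    unique = Unique.map⁺ blockSet-injective (Unique.filter⁺ _ (Unique.allFin⁺ (length ks)))
    sound : ∀ X → X ∈ₗ map blockSet (positions ks s) → DualMutualVisibility G X × ∣ X ∣ ≡ suc s
    sound X X∈ with ∈-map⁻ blockSet X∈
    ... | j , j∈ , refl with ∈-filter⁻ (λ j → lookup ks j ≟ℕ s) {xs = allFin (length ks)} j∈
    ...   | _ , size = blockSet-dmv j , trans (∣blockSet∣ j) (cong suc size)
    complete : ∀ X → DualMutualVisibility G X × ∣ X ∣ ≡ suc s → X ∈ₗ map blockSet (positions ks s)
    complete X (dmv , size) with dmv-classification dmv
    ... | inj₁ refl with trans (sym (∣⊥∣≡0 order)) size
    ...   | ()
    complete X (dmv , size) | inj₂ (j , refl) = ∈-map⁺ blockSet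
      (∈-filter⁺ (λ j → lookup ks j ≟ℕ s) (∈-allFin j) (suc-injective (trans (sym (∣blockSet∣ j)) size)))
    size : length (map blockSet (positions ks s)) ≡ multiplicity s ks
    size = trans (length-map blockSet (positions ks s)) (length-positions ks s)

corollary4p2 : (cs : List ℕ) →
    Σ Graph λ G → (Graph.order G ≥ 1) × Connected G ×
    (∀ i → DualVisCoeff G i (coeff (1 ∷ cs) i))
corollary4p2 cs = G , order≥1 , connected , coefficient
  where
  open BlockGraph (blockSizes cs)
  order≥1 : order ≥ 1
  order≥1 = ≤-trans (s≤s z≤n) (m≤n+m gadgetCount (blockTotal (blockSizes cs)))
  coefficient : ∀ i → DualVisCoeff G i (coeff (1 ∷ cs) i)
  coefficient zero    = dualVisCoeff-zero
  coefficient (suc s) = subst (DualVisCoeff G (suc s)) (multiplicity-blockSizes cs s) (dualVisCoeff-suc s)
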